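{- Let $l\geq 3$ and $n=2^l-1$. Let $G$ be one of $W_n$, $F_n$, $T_{\frac{n-1}{2}}$ or $S_n$, and let $H$ be the $l$-level hypertree $HT(l)$. Then $\mathrm{dil}(G,H)=l-1$, and $l-1$ equals the radius $r$ of $H$.
   Context: The wheel $W_n$ ($n$ vertices) consists of a cycle on $n-1$ vertices together with a hub vertex adjacent to every cycle vertex. The fan $F_n$ ($n$ vertices) consists of a path on $n-1$ vertices together with a core vertex adjacent to every path vertex. The friendship graph $T_m$ ($2m+1$ vertices) consists of $m$ triangles sharing exactly one common vertex. The star $S_n$ is $K_{1,n-1}$. The hypertree $HT(l)$ has vertex set $\{1,2,\ldots,2^l-1\}$; it contains the complete binary tree in which vertex $x$ has children $2x$ and $2x+1$ (level $i$ consists of labels $2^{i-1},\ldots,2^i-1$, $1\le i\le l$), and additionally two vertices in the same level $i$ are adjacent if their labels differ by $2^{i-2}$. An embedding of $G$ into $H$ (with $|V(G)|=|V(H)|$) is a pair $(f,P_f)$ with $f:V(G)\to V(H)$ injective and $P_f$ assigning to each edge $uv\in E(G)$ a path in $H$ between $f(u)$ and $f(v)$; $\mathrm{dil}_f(e)$ is the length of $P_f(e)$ and $\mathrm{dil}(G,H)=\min_{(f,P_f)}\max_{e\in E(G)}\mathrm{dil}_f(e)$. The radius of $H$ is the minimum over vertices $v$ of $\max_{w} d_H(v,w)$. -}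

module Defs where

open import Data.Nat using (ℕ; zero; suc; _+_; _*_; _∸_; _^_; _≤_; _<_)
open import Data.Fin using (Fin; toℕ)
open import Data.List using (List; []; _∷_)
open import Data.List.Relation.Unary.Unique.Propositional using (Unique)
open import Data.Product using (Σ; ∃; ∃-syntax; _×_; _,_)
open import Data.Sum using (_⊎_)
open import Function.Definitions using (Injective)
open import Relation.Binary.PropositionalEquality using (_≡_; _≢_)

-- Graphs on the vertex set Fin n, given by an adjacency relation.
-- Vertex v : Fin n has the natural-number label toℕ v (or toℕ v + 1
-- for the hypertree, whose labels are 1 .. 2^l - 1).

Graph : ℕ → Set₁
Graph n = Fin n → Fin n → Set

WheelAdjℕ : ℕ → ℕ → ℕ → Set
WheelAdjℕ n a b =
    (a ≡ 0 × b ≢ 0) ⊎ (b ≡ 0 × a ≢ 0)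
  ⊎ (1 ≤ a × b ≡ suc a) ⊎ (1 ≤ b × a ≡ suc b)
  ⊎ (a ≡ 1 × b ≡ n ∸ 1) ⊎ (b ≡ 1 × a ≡ n ∸ 1)

Wheel : (n : ℕ) → Graph n
Wheel n u v = WheelAdjℕ n (toℕ u) (toℕ v)

FanAdjℕ : ℕ → ℕ → Set
FanAdjℕ a b =
    (a ≡ 0 × b ≢ 0) ⊎ (b ≡ 0 × a ≢ 0)
  ⊎ (1 ≤ a × b ≡ suc a) ⊎ (1 ≤ b × a ≡ suc b)

Fan : (n : ℕ) → Graph n
Fan n u v = FanAdjℕ (toℕ u) (toℕ v)

-- Friendship graph T_m on n = 2m+1 vertices: common vertex 0,
-- triangles {0, 2i-1, 2i} for i = 1..m.

FriendAdjℕ : ℕ → ℕ → Set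
FriendAdjℕ a b =
    (a ≡ 0 × b ≢ 0) ⊎ (b ≡ 0 × a ≢ 0)
  ⊎ (∃[ i ] (a ≡ 2 * i + 1 × b ≡ 2 * i + 2))
  ⊎ (∃[ i ] (b ≡ 2 * i + 1 × a ≡ 2 * i + 2))

Friendship : (n : ℕ) → Graph n
Friendship n u v = FriendAdjℕ (toℕ u) (toℕ v)

StarAdjℕ : ℕ → ℕ → Set
StarAdjℕ a b = (a ≡ 0 × b ≢ 0) ⊎ (b ≡ 0 × a ≢ 0)

Star : (n : ℕ) → Graph n
Star n u v = StarAdjℕ (toℕ u) (toℕ v)

InLevel : ℕ → ℕ → Set
InLevel i x = 2 ^ (i ∸ 1) ≤ x × x < 2 ^ i

HTAdjℕ : ℕ → ℕ → Set
HTAdjℕ a b =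
    (b ≡ 2 * a) ⊎ (b ≡ 2 * a + 1) ⊎ (a ≡ 2 * b) ⊎ (a ≡ 2 * b + 1)
  ⊎ (∃[ i ] (2 ≤ i × InLevel i a × InLevel i b
             × (b ≡ a + 2 ^ (i ∸ 2) ⊎ a ≡ b + 2 ^ (i ∸ 2))))

HT : (l : ℕ) → Graph (2 ^ l ∸ 1)
HT l u v = HTAdjℕ (suc (toℕ u)) (suc (toℕ v))

module _ {n : ℕ} (H : Graph n) where

  data Walk : Fin n → Fin n → Set where
    [] : ∀ {x} → Walk x x
    _∷_ : ∀ {x y z} → H x y → Walk y z → Walk x z

  walkLength : ∀ {x y} → Walk x y → ℕ
  walkLength [] = 0
  walkLength (_ ∷ w) = suc (walkLength w)

  walkVertices : ∀ {x y} → Walk x y → List (Fin n)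
  walkVertices {x} [] = x ∷ []
  walkVertices {x} (_ ∷ w) = x ∷ walkVertices w

  Path : Fin n → Fin n → Set
  Path x y = Σ (Walk x y) (λ w → Unique (walkVertices w))

  pathLength : ∀ {x y} → Path x y → ℕ
  pathLength (w , _) = walkLength w

  Dist : Fin n → Fin n → ℕ → Set
  Dist x y d = (∃[ p ] (pathLength {x} {y} p ≡ d))
             × (∀ (p : Path x y) → d ≤ pathLength p)

  Ecc : Fin n → ℕ → Set
  Ecc v e = (∀ w → ∃[ d ] (Dist v w d × d ≤ e)) × (∃[ w ] Dist v w e)

  Radius : ℕ → Set
  Radius r = (∃[ v ] Ecc v r) × (∀ v e → Ecc v e → r ≤ e)

record Embedding {n : ℕ} (G H : Graph n) : Set where
  field
    f   : Fin n → Fin n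
    inj : Injective _≡_ _≡_ f
    P   : ∀ u v → G u v → Path H (f u) (f v)

open Embedding public

-- dil(G,H) = k : some embedding has all dilations ≤ k, and every
-- embedding has some edge of dilation ≥ k (i.e. min over embeddings of
-- the maximum dilation equals k; all graphs here have edges).
Dil : {n : ℕ} → Graph n → Graph n → ℕ → Set
Dil {n} G H k =
    (∃[ e ] (∀ u v (g : G u v) → pathLength H (P e u v g) ≤ k))
  × (∀ (e : Embedding G H) → ∃[ u ] ∃[ v ] Σ (G u v) λ g → k ≤ pathLength H (P e u v g))

data GuestKind : Set where
  wheel fan friendship star : GuestKind

guest : GuestKind → (n : ℕ) → Graph n
guest wheel      = Wheel
guest fan        = Fan
guest friendship = Friendship
guest star       = Star

module Submission where

-- The fan, friendship graph and star are spanning subgraphs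
-- of the wheel, so one wheel embedding serves all four: the hub goes to the
-- root, which is within l - 1 of every vertex, and the rim runs through an
-- in-order traversal of the subtree below 2 followed by a mirrored in-order
-- traversal of the subtree below 3.  Consecutive labels of a traversal are
-- within l - 2 of each other and both junctions are horizontal edges.
--
-- Every vertex of HT(l) has a vertex at distance ≥ l - 1,
-- certified by a potential that changes by at most one along each edge (the
-- level, a side potential or a region potential, according to the level of
-- the vertex).  This gives the radius, and in any embedding the hub, adjacent
-- to all other vertices, has a neighbour placed that far from it.

open import Defs
open import Data.Nat using (ℕ; zero; suc; _+_; _*_; _∸_; _^_; _≤_; _<_; z≤n; s≤s; ⌊_/2⌋; pred)
open import Data.Nat.Properties
open import Data.Nat.Logarithm using (⌊log₂_⌋; ⌊log₂⌋-mono-≤; ⌊log₂⌊n/2⌋⌋≡⌊log₂n⌋∸1; ⌊log₂[2^n]⌋≡n)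
open import Data.Nat.Tactic.RingSolver using (solve-∀)
open import Data.Product using (Σ; ∃; ∃-syntax; _×_; _,_; proj₁; proj₂)
open import Data.Sum using (_⊎_; inj₁; inj₂)
open import Data.Empty using (⊥-elim)
open import Data.Fin using (Fin; toℕ; fromℕ<; punchOut)
open import Data.Fin.Properties using (toℕ<n; toℕ-injective; toℕ-fromℕ<; pigeonhole; punchOut-injective)
  renaming (_≟_ to _≟ᶠ_; <-irrefl to <ᶠ-irrefl; any? to anyᶠ?)
open import Data.Bool using (Bool; true; false)
open import Data.List using (List; []; _∷_; _++_; length)
open import Data.List.Properties using (length-++)
open import Data.List.Membership.Propositional using (_∈_)
open import Data.List.Membership.Propositional.Properties using (∈-++⁻)
open import Data.List.Relation.Unary.Any using (here; there; any?)
open import Data.List.Relation.Unary.All as All using ([]; _∷_)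
open import Data.List.Relation.Unary.All.Properties using (¬Any⇒All¬)
open import Data.List.Relation.Unary.AllPairs using ([]; _∷_)
open import Data.List.Relation.Unary.Unique.Propositional using (Unique)
open import Data.List.Relation.Unary.Unique.Propositional.Properties using (++⁺)
open import Relation.Nullary using (¬_; yes; no)
open import Function.Definitions using (Injective)
open import Relation.Binary.PropositionalEquality

data Child (r : ℕ) : ℕ → Set where
  left  : Child r (2 * r)
  right : Child r (2 * r + 1)

half-double : ∀ r → ⌊ 2 * r /2⌋ ≡ r
half-double zero = refl
half-double (suc r) rewrite +-suc r (r + 0) = cong suc (half-double r)

half-double+1 : ∀ r → ⌊ 2 * r + 1 /2⌋ ≡ r
half-double+1 r = trans (cong ⌊_/2⌋ (+-comm (2 * r) 1)) (half-suc-double r)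
  where
    half-suc-double : ∀ r → ⌊ suc (2 * r) /2⌋ ≡ r
    half-suc-double zero = refl
    half-suc-double (suc r) rewrite +-suc r (r + 0) = cong suc (half-suc-double r)

half-child : ∀ {r c} → Child r c → ⌊ c /2⌋ ≡ r
half-child {r} left = half-double r
half-child {r} right = half-double+1 r

parent-child : ∀ x → Child ⌊ x /2⌋ x
parent-child zero = left
parent-child (suc zero) = right
parent-child (suc (suc x)) with ⌊ x /2⌋ | parent-child x
... | q | left = subst (Child (suc q)) (double-suc q) left
  where double-suc : ∀ q → 2 * suc q ≡ 2 + 2 * q
        double-suc = solve-∀
... | q | right = subst (Child (suc q)) (double-suc q) right
  where double-suc : ∀ q → 2 * suc q + 1 ≡ 2 + (2 * q + 1)
        double-suc = solve-∀

child-≥ : ∀ {r c} → Child r c → 2 * r ≤ c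
child-≥ left = ≤-refl
child-≥ {r} right = m≤m+n (2 * r) 1

child-< : ∀ {r c} → Child r c → c < 2 * suc r
child-< {r} ch = ≤-trans (s≤s (child-≤ ch)) (≤-reflexive (double-suc r))
  where
    child-≤ : ∀ {r c} → Child r c → c ≤ 2 * r + 1
    child-≤ {r} left = m≤m+n (2 * r) 1
    child-≤ right = ≤-refl
    double-suc : ∀ r → suc (2 * r + 1) ≡ 2 * suc r
    double-suc = solve-∀

parent<child : ∀ {r c} → 1 ≤ r → Child r c → r < c
parent<child {r} 1≤r ch = <-≤-trans (m<m+n r 1≤r) (≤-trans (≤-reflexive (cong (r +_) (sym (+-identityʳ r)))) (child-≥ ch))

child-pos : ∀ {r c} → 1 ≤ r → Child r c → 1 ≤ c
child-pos 1≤r ch = ≤-trans 1≤r (<⇒≤ (parent<child 1≤r ch))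

child-adj : ∀ {r c} → Child r c → HTAdjℕ r c
child-adj left = inj₁ refl
child-adj right = inj₂ (inj₁ refl)

half-+-double : ∀ a m → ⌊ a + 2 * m /2⌋ ≡ ⌊ a /2⌋ + m
half-+-double zero m = half-double m
half-+-double (suc zero) m rewrite +-comm 1 (2 * m) = half-double+1 m
half-+-double (suc (suc a)) m = cong suc (half-+-double a m)

anc : ℕ → ℕ → ℕ
anc zero x = x
anc (suc j) x = anc j ⌊ x /2⌋

anc-suc : ∀ j x → anc (suc j) x ≡ ⌊ anc j x /2⌋
anc-suc zero x = refl
anc-suc (suc j) x = anc-suc j ⌊ x /2⌋

anc-+ : ∀ i j x → anc (i + j) x ≡ anc j (anc i x)
anc-+ zero j x = refl
anc-+ (suc i) j x = anc-+ i j ⌊ x /2⌋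

anc-≤ : ∀ j x → anc j x ≤ x
anc-≤ zero x = ≤-refl
anc-≤ (suc j) x = ≤-trans (anc-≤ j ⌊ x /2⌋) (⌊n/2⌋≤n x)

anc-shift : ∀ j a c → anc j (a + 2 ^ j * c) ≡ anc j a + c
anc-shift zero a c = cong (a +_) (*-identityˡ c)
anc-shift (suc j) a c rewrite *-assoc 2 (2 ^ j) c | half-+-double a (2 ^ j * c) = anc-shift j ⌊ a /2⌋ c

anc-bound : ∀ j x → x < suc (anc j x) * 2 ^ j
anc-bound zero x = ≤-reflexive (sym (*-identityʳ (suc x)))
anc-bound (suc j) x = begin-strict
    x                                 <⟨ child-< (parent-child x) ⟩
    2 * suc ⌊ x /2⌋                   ≤⟨ *-monoʳ-≤ 2 (anc-bound j ⌊ x /2⌋) ⟩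
    2 * (suc A * 2 ^ j)               ≡⟨ reassoc (suc A) (2 ^ j) ⟩
    suc A * 2 ^ suc j                 ∎
  where
    open ≤-Reasoning
    A : ℕ
    A = anc j ⌊ x /2⌋
    reassoc : ∀ a p → 2 * (a * p) ≡ a * (2 * p)
    reassoc = solve-∀

-- Levels: label x lies on the 0-based level lev x = ⌊log₂ x⌋.

lev : ℕ → ℕ
lev x = ⌊log₂ x ⌋

lev-child : ∀ {r c} → 1 ≤ r → Child r c → lev c ≡ suc (lev r)
lev-child {r} {c} 1≤r ch = begin
    lev c                 ≡⟨ sym (suc[n∸1]≡n (lev c) 1≤lev-c) ⟩
    suc (lev c ∸ 1)       ≡⟨ cong suc (sym (⌊log₂⌊n/2⌋⌋≡⌊log₂n⌋∸1 c)) ⟩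
    suc (lev ⌊ c /2⌋)     ≡⟨ cong (λ z → suc (lev z)) (half-child ch) ⟩
    suc (lev r)           ∎
  where
    open ≡-Reasoning
    suc[n∸1]≡n : ∀ n → 1 ≤ n → suc (n ∸ 1) ≡ n
    suc[n∸1]≡n (suc n) _ = refl
    1≤lev-c : 1 ≤ lev c
    1≤lev-c = subst (_≤ lev c) (⌊log₂[2^n]⌋≡n 1)
                (⌊log₂⌋-mono-≤ (≤-trans (*-monoʳ-≤ 2 1≤r) (child-≥ ch)))

lev-1 : lev 1 ≡ 0
lev-1 = ⌊log₂[2^n]⌋≡n 0

lev-2 : lev 2 ≡ 1
lev-2 = trans (lev-child ≤-refl left) (cong suc lev-1)

lev-3 : lev 3 ≡ 1
lev-3 = trans (lev-child ≤-refl right) (cong suc lev-1)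

lev-4 : lev 4 ≡ 2
lev-4 = trans (lev-child {2} (s≤s z≤n) left) (cong suc lev-2)

lev-5 : lev 5 ≡ 2
lev-5 = trans (lev-child {2} (s≤s z≤n) right) (cong suc lev-2)

lev-parent : ∀ x → 2 ≤ x → lev x ≡ suc (lev ⌊ x /2⌋)
lev-parent x 2≤x = lev-child (⌊n/2⌋-mono 2≤x) (parent-child x)

-- the labels of the 1-based level i + 1 of the hypertree have lev = i
lev-InLevel : ∀ i x → InLevel (suc i) x → lev x ≡ i
lev-InLevel zero (suc zero) _ = lev-1
lev-InLevel zero (suc (suc _)) (_ , s≤s (s≤s ()))
lev-InLevel (suc i) x (lo , hi) =
  trans (lev-parent x 2≤x) (cong suc (lev-InLevel i ⌊ x /2⌋ (lo' , hi')))
  where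
    2≤x : 2 ≤ x
    2≤x = ≤-trans (*-monoʳ-≤ 2 (m^n>0 2 i)) lo
    lo' : 2 ^ i ≤ ⌊ x /2⌋
    lo' = subst (_≤ ⌊ x /2⌋) (half-double (2 ^ i)) (⌊n/2⌋-mono lo)
    hi' : ⌊ x /2⌋ < 2 ^ suc i
    hi' = *-cancelˡ-< 2 ⌊ x /2⌋ (2 ^ suc i) (≤-<-trans (child-≥ (parent-child x)) hi)

lev-bound : ∀ M x → x < 2 ^ suc M → lev x ≤ M
lev-bound M x x<2^M+1 = begin
    lev x     ≤⟨ ⌊log₂⌋-mono-≤ (<⇒≤pred x<2^M+1) ⟩
    lev top   ≡⟨ lev-InLevel M top (lo , hi) ⟩
    M         ∎
  where
    open ≤-Reasoning
    top : ℕ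
    top = pred (2 ^ suc M)
    lo : 2 ^ M ≤ top
    lo = <⇒≤pred (^-monoʳ-< 2 (s≤s (s≤s z≤n)) (n<1+n M))
    hi : top < 2 ^ suc M
    hi = ≤-reflexive (suc-pred (2 ^ suc M) {{m^n≢0 2 (suc M)}})

ChildMap : (ℕ → ℕ) → Set
ChildMap c = ∀ r → Child r (c r)

descend : (ℕ → ℕ) → ℕ → ℕ → ℕ
descend c r zero = r
descend c r (suc j) = descend c (c r) j

leftChild rightChild : ℕ → ℕ
leftChild r = 2 * r
rightChild r = 2 * r + 1

leftChild-map : ChildMap leftChild
leftChild-map r = left

rightChild-map : ChildMap rightChild
rightChild-map r = right

module _ {c : ℕ → ℕ} (isChild : ChildMap c) where

  descend-anc : ∀ r j → anc j (descend c r j) ≡ r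
  descend-anc r zero = refl
  descend-anc r (suc j) = begin
      anc (suc j) (descend c (c r) j)    ≡⟨ anc-suc j (descend c (c r) j) ⟩
      ⌊ anc j (descend c (c r) j) /2⌋    ≡⟨ cong ⌊_/2⌋ (descend-anc (c r) j) ⟩
      ⌊ c r /2⌋                          ≡⟨ half-child (isChild r) ⟩
      r                                  ∎
    where open ≡-Reasoning

  descend-lev : ∀ r j → 1 ≤ r → lev (descend c r j) ≡ lev r + j
  descend-lev r zero _ = sym (+-identityʳ (lev r))
  descend-lev r (suc j) 1≤r = begin
      lev (descend c (c r) j)   ≡⟨ descend-lev (c r) j (child-pos 1≤r (isChild r)) ⟩
      lev (c r) + j             ≡⟨ cong (_+ j) (lev-child 1≤r (isChild r)) ⟩
      suc (lev r) + j           ≡⟨ sym (+-suc (lev r) j) ⟩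
      lev r + suc j             ∎
    where open ≡-Reasoning

descend-lower : ∀ {c} → ChildMap c → ∀ r j → r * 2 ^ j ≤ descend c r j
descend-lower isChild r zero = ≤-reflexive (*-identityʳ r)
descend-lower {c} isChild r (suc j) = begin
    r * 2 ^ suc j        ≡⟨ reassoc r (2 ^ j) ⟩
    2 * r * 2 ^ j        ≤⟨ *-monoˡ-≤ (2 ^ j) (child-≥ (isChild r)) ⟩
    c r * 2 ^ j          ≤⟨ descend-lower isChild (c r) j ⟩
    descend c (c r) j    ∎
  where
    open ≤-Reasoning
    reassoc : ∀ a p → a * (2 * p) ≡ 2 * a * p
    reassoc = solve-∀

ShiftInvariant : (ℕ → ℕ) → Set
ShiftInvariant c = ∀ r m → c (r + m) ≡ c r + 2 * m

leftChild-shift : ShiftInvariant leftChild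
leftChild-shift r m = *-distribˡ-+ 2 r m

rightChild-shift : ShiftInvariant rightChild
rightChild-shift = shift
  where shift : ∀ r m → 2 * (r + m) + 1 ≡ 2 * r + 1 + 2 * m
        shift = solve-∀

descend-shift : ∀ {c} → ShiftInvariant c → ∀ r m j → descend c (r + m) j ≡ descend c r j + m * 2 ^ j
descend-shift inv r m zero = cong (r +_) (sym (*-identityʳ m))
descend-shift {c} inv r m (suc j) = begin
    descend c (c (r + m)) j              ≡⟨ cong (λ z → descend c z j) (inv r m) ⟩
    descend c (c r + 2 * m) j            ≡⟨ descend-shift inv (c r) (2 * m) j ⟩
    descend c (c r) j + 2 * m * 2 ^ j    ≡⟨ cong (descend c (c r) j +_) (reassoc m (2 ^ j)) ⟩
    descend c (c r) j + m * 2 ^ suc j    ∎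
  where
    open ≡-Reasoning
    reassoc : ∀ a p → 2 * a * p ≡ a * (2 * p)
    reassoc = solve-∀

InSubtree : ℕ → ℕ → ℕ → Set
InSubtree r D x = ∃[ j ] (j ≤ D × anc j x ≡ r)

subtree-root : ∀ r D → InSubtree r D r
subtree-root r D = 0 , z≤n , refl

subtree-child : ∀ {r c D x} → Child r c → InSubtree c D x → InSubtree r (suc D) x
subtree-child {x = x} ch (j , j≤D , e) =
  suc j , s≤s j≤D , trans (anc-suc j x) (trans (cong ⌊_/2⌋ e) (half-child ch))

subtree-≥ : ∀ {r D x} → InSubtree r D x → r ≤ x
subtree-≥ {x = x} (j , _ , refl) = anc-≤ j x

subtree-bound : ∀ {r D x} → InSubtree r D x → x < suc r * 2 ^ D
subtree-bound {D = D} {x} (j , j≤D , refl) =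
  <-≤-trans (anc-bound j x) (*-monoʳ-≤ (suc (anc j x)) (^-monoʳ-≤ 2 j≤D))

descend-subtree : ∀ {c} → ChildMap c → ∀ r E → InSubtree r E (descend c r E)
descend-subtree isChild r E = E , ≤-refl , descend-anc isChild r E

fits-below : ∀ {r} m j → suc r ≤ 2 ^ m → suc r * 2 ^ j ≤ 2 ^ (m + j)
fits-below {r} m j r<2^m = ≤-trans (*-monoˡ-≤ (2 ^ j) r<2^m) (≤-reflexive (sym (^-distribˡ-+-* 2 m j)))

parent∉child-subtree : ∀ {r c D} → 1 ≤ r → Child r c → ¬ InSubtree c D r
parent∉child-subtree 1≤r ch sub = <⇒≱ (parent<child 1≤r ch) (subtree-≥ sub)

anc-anc : ∀ {i j} x → i ≤ j → ∃[ d ] anc d (anc i x) ≡ anc j x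
anc-anc {i} x i≤j with m≤n⇒∃[o]m+o≡n i≤j
... | d , refl = d , sym (anc-+ i d x)

-- a proper ancestor of a child of r lies at or above r, so it is no child of r
ancestor-of-child : ∀ {r c c'} → 1 ≤ r → Child r c → Child r c' → ∀ d → anc d c ≡ c' → c ≡ c'
ancestor-of-child _ _ _ zero e = e
ancestor-of-child {r} {c} {c'} 1≤r ch ch' (suc d) e = ⊥-elim (<⇒≱ (parent<child 1≤r ch') c'≤r)
  where
    open ≤-Reasoning
    c'≤r : c' ≤ r
    c'≤r = begin
      c'              ≡⟨ sym e ⟩
      anc d ⌊ c /2⌋   ≡⟨ cong (anc d) (half-child ch) ⟩
      anc d r         ≤⟨ anc-≤ d r ⟩
      r               ∎

sibling-subtrees : ∀ {r c c' D D' x} → 1 ≤ r → Child r c → Child r c' →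
                   InSubtree c D x → InSubtree c' D' x → c ≡ c'
sibling-subtrees {x = x} 1≤r ch ch' (i , _ , refl) (j , _ , refl) with ≤-total i j
... | inj₁ i≤j = ancestor-of-child 1≤r ch ch' (proj₁ (anc-anc x i≤j)) (proj₂ (anc-anc x i≤j))
... | inj₂ j≤i = sym (ancestor-of-child 1≤r ch' ch (proj₁ (anc-anc x j≤i)) (proj₂ (anc-anc x j≤i)))

firstChild secondChild : Bool → ℕ → ℕ
firstChild false = leftChild
firstChild true = rightChild
secondChild false = rightChild
secondChild true = leftChild

firstChild-map : ∀ b → ChildMap (firstChild b)
firstChild-map false = leftChild-map
firstChild-map true = rightChild-map

secondChild-map : ∀ b → ChildMap (secondChild b)
secondChild-map false = rightChild-map
secondChild-map true = leftChild-map

firstChild≢secondChild : ∀ b r → firstChild b r ≢ secondChild b r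
firstChild≢secondChild false r = <⇒≢ (m<m+n (2 * r) (s≤s z≤n))
firstChild≢secondChild true r = ≢-sym (<⇒≢ (m<m+n (2 * r) (s≤s z≤n)))

inorder : Bool → ℕ → ℕ → List ℕ
inorder b r zero = r ∷ []
inorder b r (suc D) = inorder b (firstChild b r) D ++ r ∷ inorder b (secondChild b r) D

inorder-subtree : ∀ b r D {x} → x ∈ inorder b r D → InSubtree r D x
inorder-subtree b r zero (here refl) = subtree-root r zero
inorder-subtree b r (suc D) x∈ with ∈-++⁻ (inorder b (firstChild b r) D) x∈
... | inj₁ x∈first = subtree-child (firstChild-map b r) (inorder-subtree b (firstChild b r) D x∈first)
... | inj₂ (here refl) = subtree-root r (suc D)
... | inj₂ (there x∈second) = subtree-child (secondChild-map b r) (inorder-subtree b (secondChild b r) D x∈second)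

inorder-length : ∀ b r D → suc (length (inorder b r D)) ≡ 2 ^ suc D
inorder-length b r zero = refl
inorder-length b r (suc D) = begin
    suc (length (first ++ r ∷ second))          ≡⟨ cong suc (length-++ first) ⟩
    suc (length first) + suc (length second)    ≡⟨ cong₂ _+_ (inorder-length b (firstChild b r) D) (inorder-length b (secondChild b r) D) ⟩
    2 ^ suc D + 2 ^ suc D                       ≡⟨ cong (2 ^ suc D +_) (sym (+-identityʳ (2 ^ suc D))) ⟩
    2 ^ suc (suc D)                             ∎
  where
    open ≡-Reasoning
    first = inorder b (firstChild b r) D
    second = inorder b (secondChild b r) D

inorder-unique : ∀ b r D → 1 ≤ r → Unique (inorder b r D)
inorder-unique b r zero _ = [] ∷ []
inorder-unique b r (suc D) 1≤r =
  ++⁺ (inorder-unique b c₁ D (child-pos 1≤r (firstChild-map b r)))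
      (All.tabulate r∉second ∷ inorder-unique b c₂ D (child-pos 1≤r (secondChild-map b r)))
      disjoint
  where
    c₁ = firstChild b r
    c₂ = secondChild b r
    r∉second : ∀ {x} → x ∈ inorder b c₂ D → r ≢ x
    r∉second x∈ refl = parent∉child-subtree 1≤r (secondChild-map b r) (inorder-subtree b c₂ D x∈)
    disjoint : ∀ {x} → ¬ (x ∈ inorder b c₁ D × x ∈ r ∷ inorder b c₂ D)
    disjoint (x∈first , here refl) = parent∉child-subtree 1≤r (firstChild-map b r) (inorder-subtree b c₁ D x∈first)
    disjoint (x∈first , there x∈second) =
      firstChild≢secondChild b r (sibling-subtrees 1≤r (firstChild-map b r) (secondChild-map b r)
        (inorder-subtree b c₁ D x∈first) (inorder-subtree b c₂ D x∈second))

-- at xs i is the i-th entry of xs (0 past the end)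
at : List ℕ → ℕ → ℕ
at [] _ = 0
at (x ∷ xs) zero = x
at (x ∷ xs) (suc i) = at xs i

at-∈ : ∀ xs i → i < length xs → at xs i ∈ xs
at-∈ (x ∷ xs) zero _ = here refl
at-∈ (x ∷ xs) (suc i) (s≤s i<) = there (at-∈ xs i i<)

at-injective : ∀ xs → Unique xs → ∀ i j → i < length xs → j < length xs → at xs i ≡ at xs j → i ≡ j
at-injective (x ∷ xs) u zero zero _ _ _ = refl
at-injective (x ∷ xs) (x∉ ∷ u) zero (suc j) _ (s≤s j<) e = ⊥-elim (All.lookup x∉ (at-∈ xs j j<) e)
at-injective (x ∷ xs) (x∉ ∷ u) (suc i) zero (s≤s i<) _ e = ⊥-elim (All.lookup x∉ (at-∈ xs i i<) (sym e))
at-injective (x ∷ xs) (_ ∷ u) (suc i) (suc j) (s≤s i<) (s≤s j<) e = cong suc (at-injective xs u i j i< j< e)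

data Chain (R : ℕ → ℕ → Set) : ℕ → ℕ → List ℕ → Set where
  [_] : ∀ x → Chain R x x (x ∷ [])
  _∷_ : ∀ {x y z ys} → R x y → Chain R y z ys → Chain R x z (x ∷ ys)

module _ {R : ℕ → ℕ → Set} where

  chain-++ : ∀ {x y z w xs ys} → Chain R x y xs → R y z → Chain R z w ys → Chain R x w (xs ++ ys)
  chain-++ [ _ ] r c₂ = r ∷ c₂
  chain-++ (r' ∷ c₁) r c₂ = r' ∷ chain-++ c₁ r c₂

  chain-map : ∀ {R' : ℕ → ℕ → Set} → (∀ {a b} → R a b → R' a b) → ∀ {x y xs} → Chain R x y xs → Chain R' x y xs
  chain-map f [ x ] = [ x ]
  chain-map f (r ∷ c) = f r ∷ chain-map f c

  chain-step : ∀ {x y xs} → Chain R x y xs → ∀ i → suc i < length xs → R (at xs i) (at xs (suc i))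
  chain-step [ _ ] i (s≤s ())
  chain-step (r ∷ [ _ ]) zero _ = r
  chain-step (r ∷ (r' ∷ c)) zero _ = r
  chain-step (_ ∷ c) (suc i) (s≤s i<) = chain-step c i i<

  chain-head : ∀ {x y xs} → Chain R x y xs → at xs 0 ≡ x
  chain-head [ _ ] = refl
  chain-head (_ ∷ _) = refl

  -- the last entry of xs is the entry of z ∷ xs at index length xs
  chain-last : ∀ {x y xs} → Chain R x y xs → ∀ z → at (z ∷ xs) (length xs) ≡ y
  chain-last [ _ ] z = refl
  chain-last (_ ∷ c) z = chain-last c _

-- Leading bits.  bit k x is the parity of the ancestor of x on level k,
-- i.e. the k-th binary digit of x after its leading one.  The side of x
-- (bit 1) tells whether x lies below 2 or below 3, its region (bit 2)
-- whether it lies below an even or an odd label of level 2.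

parity : ℕ → ℕ
parity zero = 0
parity (suc zero) = 1
parity (suc (suc n)) = parity n

parity-+2 : ∀ m → parity (m + 2) ≡ parity m
parity-+2 zero = refl
parity-+2 (suc zero) = refl
parity-+2 (suc (suc m)) = parity-+2 m

parity-≤1 : ∀ m → parity m ≤ 1
parity-≤1 zero = z≤n
parity-≤1 (suc zero) = ≤-refl
parity-≤1 (suc (suc m)) = parity-≤1 m

parity-0or1 : ∀ m → parity m ≡ 0 ⊎ parity m ≡ 1
parity-0or1 zero = inj₁ refl
parity-0or1 (suc zero) = inj₂ refl
parity-0or1 (suc (suc m)) = parity-0or1 m

bit : ℕ → ℕ → ℕ
bit k x = parity (anc (lev x ∸ k) x)

bit-0or1 : ∀ k x → bit k x ≡ 0 ⊎ bit k x ≡ 1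
bit-0or1 k x = parity-0or1 (anc (lev x ∸ k) x)

side region : ℕ → ℕ
side = bit 1
region = bit 2

bit-child : ∀ {a c} k → 1 ≤ a → Child a c → k ≤ lev a → bit k c ≡ bit k a
bit-child {a} {c} k 1≤a ch k≤lev =
  cong parity (begin
    anc (lev c ∸ k) c             ≡⟨ cong (λ n → anc (n ∸ k) c) (lev-child 1≤a ch) ⟩
    anc (suc (lev a) ∸ k) c       ≡⟨ cong (λ n → anc n c) (+-∸-assoc 1 k≤lev) ⟩
    anc (lev a ∸ k) ⌊ c /2⌋       ≡⟨ cong (anc (lev a ∸ k)) (half-child ch) ⟩
    anc (lev a ∸ k) a             ∎)
  where open ≡-Reasoning

bit-descend : ∀ {c} → ChildMap c → ∀ k r j → 1 ≤ r → lev r ≡ k → bit k (descend c r j) ≡ parity r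
bit-descend isChild k r j 1≤r refl =
  cong parity (trans (cong (λ n → anc n (descend _ r j)) lev∸k≡j) (descend-anc isChild r j))
  where
    lev∸k≡j : lev (descend _ r j) ∸ lev r ≡ j
    lev∸k≡j = trans (cong (_∸ lev r) (descend-lev isChild r j 1≤r)) (m+n∸m≡n (lev r) j)

region-across : ∀ m a → lev a ≡ suc (suc m) → lev (a + 2 ^ suc m) ≡ suc (suc m) →
                region (a + 2 ^ suc m) ≡ region a
region-across m a la lb rewrite la | lb | *-comm 2 (2 ^ m) | anc-shift m a 2 = parity-+2 (anc m a)

record TreeStep (a c : ℕ) : Set where
  field
    lev-step    : lev c ≡ suc (lev a)
    side-step   : 1 ≤ lev a → side c ≡ side a
    region-step : 2 ≤ lev a → region c ≡ region a

open TreeStep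

data EdgeKind (a b : ℕ) : Set where
  down   : TreeStep a b → EdgeKind a b
  up     : TreeStep b a → EdgeKind a b
  across : lev a ≡ lev b → 1 ≤ lev a → (2 ≤ lev a → region b ≡ region a) → EdgeKind a b

tree-step : ∀ {a c} → 1 ≤ a → Child a c → TreeStep a c
tree-step 1≤a ch = record
  { lev-step    = lev-child 1≤a ch
  ; side-step   = bit-child 1 1≤a ch
  ; region-step = bit-child 2 1≤a ch
  }

across-region : ∀ j a b → lev a ≡ suc j → lev b ≡ suc j → b ≡ a + 2 ^ j →
                2 ≤ suc j → region b ≡ region a
across-region (suc m) a b la lb refl _ = region-across m a la lb
across-region zero _ _ _ _ _ (s≤s ())

classify : ∀ {a b} → 1 ≤ a → 1 ≤ b → HTAdjℕ a b → EdgeKind a b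
classify 1≤a _ (inj₁ refl) = down (tree-step 1≤a left)
classify 1≤a _ (inj₂ (inj₁ refl)) = down (tree-step 1≤a right)
classify _ 1≤b (inj₂ (inj₂ (inj₁ refl))) = up (tree-step 1≤b left)
classify _ 1≤b (inj₂ (inj₂ (inj₂ (inj₁ refl)))) = up (tree-step 1≤b right)
classify {a} {b} _ _ (inj₂ (inj₂ (inj₂ (inj₂ (suc (suc j) , _ , ina , inb , shift))))) =
  across (trans la (sym lb)) (subst (1 ≤_) (sym la) (s≤s z≤n)) (λ 2≤ → same-region shift (subst (2 ≤_) la 2≤))
  where
    la : lev a ≡ suc j
    la = lev-InLevel (suc j) a ina
    lb : lev b ≡ suc j
    lb = lev-InLevel (suc j) b inb
    same-region : (b ≡ a + 2 ^ j ⊎ a ≡ b + 2 ^ j) → 2 ≤ suc j → region b ≡ region a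
    same-region (inj₁ e) = across-region j a b la lb e
    same-region (inj₂ e) 2≤ = sym (across-region j b a lb la e 2≤)
classify _ _ (inj₂ (inj₂ (inj₂ (inj₂ (suc zero , s≤s () , _)))))

HTAdj-sym : ∀ {a b} → HTAdjℕ a b → HTAdjℕ b a
HTAdj-sym (inj₁ e) = inj₂ (inj₂ (inj₁ e))
HTAdj-sym (inj₂ (inj₁ e)) = inj₂ (inj₂ (inj₂ (inj₁ e)))
HTAdj-sym (inj₂ (inj₂ (inj₁ e))) = inj₁ e
HTAdj-sym (inj₂ (inj₂ (inj₂ (inj₁ e)))) = inj₂ (inj₁ e)
HTAdj-sym (inj₂ (inj₂ (inj₂ (inj₂ (i , 2≤i , ina , inb , inj₁ e))))) = inj₂ (inj₂ (inj₂ (inj₂ (i , 2≤i , inb , ina , inj₂ e))))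
HTAdj-sym (inj₂ (inj₂ (inj₂ (inj₂ (i , 2≤i , ina , inb , inj₂ e))))) = inj₂ (inj₂ (inj₂ (inj₂ (i , 2≤i , inb , ina , inj₁ e))))

across-edge : ∀ j a → 2 ^ suc j ≤ a → a + 2 ^ j < 2 ^ suc (suc j) → HTAdjℕ a (a + 2 ^ j)
across-edge j a lo hi = inj₂ (inj₂ (inj₂ (inj₂
  (suc (suc j) , s≤s (s≤s z≤n) , (lo , ≤-<-trans (m≤m+n a (2 ^ j)) hi) , (≤-trans lo (m≤m+n a (2 ^ j)) , hi) , inj₁ refl))))

sibling-leaves-across : ∀ {c} → ChildMap c → ShiftInvariant c → ∀ D →
                        HTAdjℕ (descend c 2 D) (descend c 3 D)
sibling-leaves-across {c} isChild inv D = subst (HTAdjℕ a) (sym b≡a+2^D) (across-edge D a lo hi)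
  where
    a = descend c 2 D
    b≡a+2^D : descend c 3 D ≡ a + 2 ^ D
    b≡a+2^D = trans (descend-shift inv 2 1 D) (cong (a +_) (*-identityˡ (2 ^ D)))
    lo : 2 ^ suc D ≤ a
    lo = descend-lower isChild 2 D
    hi : a + 2 ^ D < 2 ^ suc (suc D)
    hi = subst (_< 2 ^ suc (suc D)) b≡a+2^D
           (<-≤-trans (subtree-bound (descend-subtree isChild 3 D)) (fits-below 2 D ≤-refl))

-- Potentials.  A potential that grows by at most one along every
-- hypertree edge bounds the length of every walk from below.

Lipschitz : (ℕ → ℕ) → Set
Lipschitz φ = ∀ {a b} → EdgeKind a b → φ b ≤ suc (φ a)

lev-lipschitz : Lipschitz lev
lev-lipschitz (down st) = ≤-reflexive (lev-step st)
lev-lipschitz (up st) = ≤-trans (n≤1+n _) (≤-trans (≤-reflexive (sym (lev-step st))) (n≤1+n _))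
lev-lipschitz (across e _ _) = ≤-trans (≤-reflexive (sym e)) (n≤1+n _)

-- The side potential measures the way to the side opposite to s: it is 1
-- at the root and level + [side ≠ s] elsewhere.  The mismatch d is
-- parity (side + s).

sideWeight : ℕ → ℕ → ℕ
sideWeight zero _ = 1
sideWeight (suc m) d = suc m + d

sidePot : ℕ → ℕ → ℕ
sidePot s x = sideWeight (lev x) (parity (side x + s))

mismatch-cong : ∀ s {x y} → x ≡ y → parity (x + s) ≡ parity (y + s)
mismatch-cong s = cong (λ z → parity (z + s))

sideWeight-down : ∀ L {L' d d'} → L' ≡ suc L → (1 ≤ L → d' ≡ d) → d' ≤ 1 →
                  sideWeight L' d' ≤ suc (sideWeight L d)
sideWeight-down zero refl _ d'≤1 = s≤s d'≤1
sideWeight-down (suc L) refl e _ rewrite e (s≤s z≤n) = ≤-refl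

sideWeight-up : ∀ L {L' d d'} → L' ≡ suc L → (1 ≤ L → d' ≡ d) →
                sideWeight L d ≤ suc (sideWeight L' d')
sideWeight-up zero refl _ = s≤s z≤n
sideWeight-up (suc L) refl e rewrite e (s≤s z≤n) = ≤-trans (n≤1+n _) (n≤1+n _)

sideWeight-across : ∀ L {L' d d'} → L ≡ L' → 1 ≤ L → d' ≤ 1 →
                    sideWeight L' d' ≤ suc (sideWeight L d)
sideWeight-across (suc L) {d = d} refl _ d'≤1 =
  s≤s (≤-trans (+-monoʳ-≤ L d'≤1) (≤-trans (≤-reflexive (+-comm L 1)) (s≤s (m≤m+n L d))))

sidePot-lipschitz : ∀ s → Lipschitz (sidePot s)
sidePot-lipschitz s {a} {b} (down st) =
  sideWeight-down (lev a) (lev-step st) (λ q → mismatch-cong s (side-step st q)) (parity-≤1 (side b + s))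
sidePot-lipschitz s {a} {b} (up st) =
  sideWeight-up (lev b) (lev-step st) (λ q → mismatch-cong s (side-step st q))
sidePot-lipschitz s {a} {b} (across e 1≤lev _) =
  sideWeight-across (lev a) e 1≤lev (parity-≤1 (side b + s))

-- A vertex deep inside region c is therefore
-- far from the leaves outside of it.

regionWeight : ℕ → ℕ → ℕ → ℕ
regionWeight l zero _ = l
regionWeight l (suc zero) _ = suc l
regionWeight l (suc (suc m)) zero = l ∸ m
regionWeight l (suc (suc m)) (suc _) = l + 2 + m

regionPot : ℕ → ℕ → ℕ → ℕ
regionPot l c x = regionWeight l (lev x) (parity (region x + c))

∸-step : ∀ m n → m ∸ n ≤ suc (m ∸ suc n)
∸-step zero zero = z≤n
∸-step zero (suc n) = z≤n
∸-step (suc m) zero = ≤-refl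
∸-step (suc m) (suc n) = ∸-step m n

regionWeight-down : ∀ l L d {L' d'} → L' ≡ suc L → (2 ≤ L → d' ≡ d) →
                    regionWeight l L' d' ≤ suc (regionWeight l L d)
regionWeight-down l zero _ refl _ = ≤-refl
regionWeight-down l (suc zero) _ {d' = zero} refl _ = ≤-trans (n≤1+n l) (n≤1+n _)
regionWeight-down l (suc zero) _ {d' = suc _} refl _ = ≤-reflexive (trans (+-identityʳ _) (+-comm l 2))
regionWeight-down l (suc (suc m)) zero refl e rewrite e (s≤s (s≤s z≤n)) = ≤-trans (∸-monoʳ-≤ l (n≤1+n m)) (n≤1+n _)
regionWeight-down l (suc (suc m)) (suc _) refl e rewrite e (s≤s (s≤s z≤n)) = ≤-reflexive (+-suc _ _)

regionWeight-up : ∀ l L d {L' d'} → L' ≡ suc L → (2 ≤ L → d' ≡ d) →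
                  regionWeight l L d ≤ suc (regionWeight l L' d')
regionWeight-up l zero _ refl _ = ≤-trans (n≤1+n l) (n≤1+n _)
regionWeight-up l (suc zero) _ {d' = zero} refl _ = ≤-refl
regionWeight-up l (suc zero) _ {d' = suc _} refl _ = s≤s (≤-trans (m≤m+n l 2) (≤-reflexive (sym (+-identityʳ _))))
regionWeight-up l (suc (suc m)) zero refl e rewrite e (s≤s (s≤s z≤n)) = ∸-step l m
regionWeight-up l (suc (suc m)) (suc _) refl e rewrite e (s≤s (s≤s z≤n)) =
  ≤-trans (n≤1+n _) (≤-trans (≤-reflexive (sym (+-suc _ _))) (n≤1+n _))

regionWeight-across : ∀ l L d {L' d'} → L ≡ L' → 1 ≤ L → (2 ≤ L → d' ≡ d) →
                      regionWeight l L' d' ≤ suc (regionWeight l L d)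
regionWeight-across l (suc zero) _ refl _ _ = n≤1+n _
regionWeight-across l (suc (suc m)) d refl _ e rewrite e (s≤s (s≤s z≤n)) = n≤1+n _

regionPot-lipschitz : ∀ l c → Lipschitz (regionPot l c)
regionPot-lipschitz l c {a} (down st) =
  regionWeight-down l (lev a) _ (lev-step st) (λ q → mismatch-cong c (region-step st q))
regionPot-lipschitz l c {b = b} (up st) =
  regionWeight-up l (lev b) _ (lev-step st) (λ q → mismatch-cong c (region-step st q))
regionPot-lipschitz l c {a} (across e 1≤lev same) =
  regionWeight-across l (lev a) _ e 1≤lev (λ q → mismatch-cong c (same q))

sidePot-leaf : ∀ s r j → 1 ≤ r → lev r ≡ 1 →
               sidePot s (descend leftChild r j) ≡ suc j + parity (parity r + s)
sidePot-leaf s r j 1≤r lev-r =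
  cong₂ sideWeight (trans (descend-lev leftChild-map r j 1≤r) (cong (_+ j) lev-r))
                   (mismatch-cong s (bit-descend leftChild-map 1 r j 1≤r lev-r))

regionPot-leaf : ∀ l c r j → 1 ≤ r → lev r ≡ 2 →
                 regionPot l c (descend leftChild r j) ≡ regionWeight l (2 + j) (parity (parity r + c))
regionPot-leaf l c r j 1≤r lev-r =
  cong₂ (regionWeight l) (trans (descend-lev leftChild-map r j 1≤r) (cong (_+ j) lev-r))
                         (mismatch-cong c (bit-descend leftChild-map 2 r j 1≤r lev-r))

module _ {n : ℕ} (H : Graph n) where

  path-suffix : ∀ {x y z} (w : Walk H y z) → Unique (walkVertices H w) → x ∈ walkVertices H w →
                Σ (Walk H x z) λ w' → Unique (walkVertices H w') × walkLength H w' ≤ walkLength H w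
  path-suffix [] u (here refl) = [] , u , z≤n
  path-suffix (e ∷ w) u (here refl) = e ∷ w , u , ≤-refl
  path-suffix (e ∷ w) (_ ∷ u) (there x∈w) with path-suffix w u x∈w
  ... | w' , u' , w'≤w = w' , u' , m≤n⇒m≤1+n w'≤w

  walk⇒path : ∀ {x y} (w : Walk H x y) → Σ (Path H x y) λ p → pathLength H p ≤ walkLength H w
  walk⇒path [] = ([] , [] ∷ []) , z≤n
  walk⇒path {x} (e ∷ w) with walk⇒path w
  ... | (p , u) , p≤w with any? (x ≟ᶠ_) (walkVertices H p)
  ...   | yes x∈p = let (p' , u' , p'≤p) = path-suffix p u x∈p in (p' , u') , ≤-trans p'≤p (m≤n⇒m≤1+n p≤w)
  ...   | no x∉p = (e ∷ p , ¬Any⇒All¬ _ x∉p ∷ u) , s≤s p≤w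

  reverse-walk : (∀ {u v} → H u v → H v u) → ∀ {x y} (w : Walk H x y) →
                 Σ (Walk H y x) λ r → walkLength H r ≡ walkLength H w
  reverse-walk sym-H w = let (r , e) = onto w [] in r , trans e (+-identityʳ _)
    where
      onto : ∀ {x y z} (w : Walk H x y) (acc : Walk H x z) →
             Σ (Walk H y z) λ r → walkLength H r ≡ walkLength H w + walkLength H acc
      onto [] acc = acc , refl
      onto (e ∷ w) acc = let (r , len) = onto w (sym-H e ∷ acc) in r , trans len (+-suc _ _)

module Hypertree (h : ℕ) where

  L : ℕ
  L = suc h

  N : ℕ
  N = 2 ^ L ∸ 1

  lab : Fin N → ℕ
  lab v = suc (toℕ v)

  InRange : ℕ → Set
  InRange x = 1 ≤ x × x < 2 ^ L

  N≡pred : pred (2 ^ L) ≡ N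
  N≡pred = pred[m∸n]≡m∸[1+n] (2 ^ L) 0

  lab-range : ∀ v → InRange (lab v)
  lab-range v = s≤s z≤n , m≤pred[n]⇒suc[m]≤n {{m^n≢0 2 L}} (subst (lab v ≤_) (sym N≡pred) (toℕ<n v))

  lab-injective : ∀ {u v} → lab u ≡ lab v → u ≡ v
  lab-injective e = toℕ-injective (suc-injective e)

  vertex : ∀ x → InRange x → Fin N
  vertex (suc x) (_ , x<2^L) = fromℕ< (subst (x <_) N≡pred (<⇒≤pred x<2^L))

  lab-vertex : ∀ x (range : InRange x) → lab (vertex x range) ≡ x
  lab-vertex (suc x) (_ , x<2^L) = cong suc (toℕ-fromℕ< _)

  root : Fin N
  root = vertex 1 (s≤s z≤n , *-monoʳ-≤ 2 (m^n>0 2 h))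

  lab-root : lab root ≡ 1
  lab-root = lab-vertex 1 (s≤s z≤n , *-monoʳ-≤ 2 (m^n>0 2 h))

  walk-potential : ∀ {φ} → Lipschitz φ → ∀ {x y} (w : Walk (HT L) x y) →
                   φ (lab y) ≤ walkLength (HT L) w + φ (lab x)
  walk-potential lip [] = ≤-refl
  walk-potential {φ} lip {x} (_∷_ {y = m} e w) = begin
      φ (lab _)                               ≤⟨ walk-potential lip w ⟩
      walkLength (HT L) w + φ (lab m)         ≤⟨ +-monoʳ-≤ (walkLength (HT L) w) (lip (classify (s≤s z≤n) (s≤s z≤n) e)) ⟩
      walkLength (HT L) w + suc (φ (lab x))   ≡⟨ +-suc _ _ ⟩
      suc (walkLength (HT L) w + φ (lab x))   ∎
    where open ≤-Reasoning

  data LabelWalk : ℕ → ℕ → Set where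
    []   : ∀ {a} → LabelWalk a a
    step : ∀ {a b c} → HTAdjℕ a b → InRange b → LabelWalk b c → LabelWalk a c

  lengthᴸ : ∀ {a b} → LabelWalk a b → ℕ
  lengthᴸ [] = 0
  lengthᴸ (step _ _ w) = suc (lengthᴸ w)

  labelWalk⇒walk : ∀ {s t a b} → lab s ≡ a → lab t ≡ b → (w : LabelWalk a b) →
                   Σ (Walk (HT L) s t) λ w' → walkLength (HT L) w' ≡ lengthᴸ w
  labelWalk⇒walk {s} {t} es et [] with lab-injective (trans es (sym et))
  ... | refl = [] , refl
  labelWalk⇒walk {s} es et (step {b = m} e range w) =
    let (w' , len) = labelWalk⇒walk (lab-vertex m range) et w
    in (subst₂ HTAdjℕ (sym es) (sym (lab-vertex m range)) e ∷ w') , cong suc len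

  Near : ℕ → ℕ → ℕ → Set
  Near E x y = (Σ (LabelWalk x y) λ w → lengthᴸ w ≤ E) ⊎ (Σ (LabelWalk y x) λ w → lengthᴸ w ≤ E)

  near-sym : ∀ {E x y} → Near E x y → Near E y x
  near-sym (inj₁ w) = inj₂ w
  near-sym (inj₂ w) = inj₁ w

  near-weaken : ∀ {E E' x y} → E ≤ E' → Near E x y → Near E' x y
  near-weaken E≤E' (inj₁ (w , len)) = inj₁ (w , ≤-trans len E≤E')
  near-weaken E≤E' (inj₂ (w , len)) = inj₂ (w , ≤-trans len E≤E')

  near⇒path : ∀ {E} s t → Near E (lab s) (lab t) → Σ (Path (HT L) s t) λ p → pathLength (HT L) p ≤ E
  near⇒path s t (inj₁ (w , len)) =
    let (w' , len') = labelWalk⇒walk refl refl w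
        (p , p≤w') = walk⇒path (HT L) w'
    in p , ≤-trans p≤w' (≤-trans (≤-reflexive len') len)
  near⇒path s t (inj₂ (w , len)) =
    let (w' , len') = labelWalk⇒walk refl refl w
        (r , lenʳ) = reverse-walk (HT L) HTAdj-sym w'
        (p , p≤r) = walk⇒path (HT L) r
    in p , ≤-trans p≤r (≤-trans (≤-reflexive (trans lenʳ len')) len)

  climb : ∀ j x → InRange x → lev x ≡ j → Σ (LabelWalk x 1) λ w → lengthᴸ w ≡ j
  climb zero (suc zero) _ _ = [] , refl
  climb zero x@(suc (suc _)) _ e = ⊥-elim (0≢1+n (trans (sym e) (lev-parent x (s≤s (s≤s z≤n)))))
  climb (suc j) (suc zero) _ e = ⊥-elim (0≢1+n (trans (sym lev-1) e))
  climb (suc j) x@(suc (suc _)) (_ , x<2^L) e =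
    let (w , len) = climb j ⌊ x /2⌋ parent-range parent-lev
    in step (HTAdj-sym (child-adj (parent-child x))) parent-range w , cong suc len
    where
      parent-range : InRange ⌊ x /2⌋
      parent-range = ⌊n/2⌋-mono (s≤s (s≤s z≤n)) , ≤-<-trans (⌊n/2⌋≤n x) x<2^L
      parent-lev : lev ⌊ x /2⌋ ≡ j
      parent-lev = suc-injective (trans (sym (lev-parent x (s≤s (s≤s z≤n)))) e)

  root-near : ∀ x → InRange x → Near (lev x) 1 x
  root-near x range = let (w , len) = climb (lev x) x range refl in inj₂ (w , ≤-reflexive len)

  lev-range : ∀ x → InRange x → lev x ≤ h
  lev-range x (_ , x<2^L) = lev-bound h x x<2^L

  root-distance : ∀ w → Dist (HT L) root w (lev (lab w))
  root-distance w = (p , ≤-antisym p≤lev (lower p)) , lower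
    where
      lower : ∀ p → lev (lab w) ≤ pathLength (HT L) p
      lower (p , _) = subst (lev (lab w) ≤_) at-root (walk-potential lev-lipschitz p)
        where
          at-root : walkLength (HT L) p + lev (lab root) ≡ walkLength (HT L) p
          at-root = trans (cong (λ z → walkLength (HT L) p + lev z) lab-root) (+-identityʳ _)
      near : Near (lev (lab w)) (lab root) (lab w)
      near = subst (λ z → Near (lev (lab w)) z (lab w)) (sym lab-root) (root-near (lab w) (lab-range w))
      p = proj₁ (near⇒path root w near)
      p≤lev = proj₂ (near⇒path root w near)

  Fits : ℕ → ℕ → Set
  Fits r E = suc r * 2 ^ E ≤ 2 ^ L

  subtree-range : ∀ {r E x} → 1 ≤ r → Fits r E → InSubtree r E x → InRange x
  subtree-range 1≤r fits sub = ≤-trans 1≤r (subtree-≥ sub) , <-≤-trans (subtree-bound sub) fits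

  descend-range : ∀ {c} → ChildMap c → ∀ r E → 1 ≤ r → Fits r E → InRange (descend c r E)
  descend-range isChild r E 1≤r fits = subtree-range 1≤r fits (descend-subtree isChild r E)

  fits-child : ∀ {r c} E → Child r c → Fits r (suc E) → Fits c E
  fits-child {r} {c} E ch fits = begin
      suc c * 2 ^ E         ≤⟨ *-monoˡ-≤ (2 ^ E) (child-< ch) ⟩
      2 * suc r * 2 ^ E     ≡⟨ reassoc (suc r) (2 ^ E) ⟩
      suc r * 2 ^ suc E     ≤⟨ fits ⟩
      2 ^ L                 ∎
    where
      open ≤-Reasoning
      reassoc : ∀ a p → 2 * a * p ≡ a * (2 * p)
      reassoc = solve-∀

  fits-range : ∀ {r} E → 1 ≤ r → Fits r E → InRange r
  fits-range {r} E 1≤r fits = subtree-range 1≤r fits (subtree-root r E)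

  descend-walk : ∀ {c} → ChildMap c → ∀ r E → 1 ≤ r → Fits r E →
                 Σ (LabelWalk r (descend c r E)) λ w → lengthᴸ w ≡ E
  descend-walk isChild r zero _ _ = [] , refl
  descend-walk {c} isChild r (suc E) 1≤r fits =
    let (w , len) = descend-walk isChild (c r) E 1≤cr fits-cr
    in step (child-adj (isChild r)) (fits-range E 1≤cr fits-cr) w , cong suc len
    where
      1≤cr = child-pos 1≤r (isChild r)
      fits-cr = fits-child E (isChild r) fits

  -- consecutive labels of an in-order traversal of depth E are within
  -- distance E: the traversal alternates between a label and the last
  -- (first) label of the subtree below its first (second) child
  inorder-chain : ∀ b r E → 1 ≤ r → Fits r E →
                  Chain (Near E) (descend (firstChild b) r E) (descend (secondChild b) r E) (inorder b r E)
  inorder-chain b r zero _ _ = [ r ]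
  inorder-chain b r (suc E) 1≤r fits =
    chain-++ (chain-map (near-weaken (n≤1+n E)) (inorder-chain b c₁ E (child-pos 1≤r c₁-child) fits₁))
             up-from-first
             (down-to-second ∷ chain-map (near-weaken (n≤1+n E)) (inorder-chain b c₂ E (child-pos 1≤r c₂-child) fits₂))
    where
      c₁ = firstChild b r
      c₂ = secondChild b r
      c₁-child = firstChild-map b r
      c₂-child = secondChild-map b r
      fits₁ = fits-child E c₁-child fits
      fits₂ = fits-child E c₂-child fits
      via-child : ∀ {c c'} → Child r c → ChildMap c' → Fits c E → Near (suc E) r (descend c' c E)
      via-child {c} ch isChild' fits-c =
        let (w , len) = descend-walk isChild' c E (child-pos 1≤r ch) fits-c
        in inj₁ (step (child-adj ch) (fits-range E (child-pos 1≤r ch) fits-c) w , ≤-reflexive (cong suc len))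
      up-from-first : Near (suc E) (descend (secondChild b) c₁ E) r
      up-from-first = near-sym (via-child c₁-child (secondChild-map b) fits₁)
      down-to-second : Near (suc E) r (descend (firstChild b) c₂ E)
      down-to-second = via-child c₂-child (firstChild-map b) fits₂

  root-eccentricity : Ecc (HT L) root h
  root-eccentricity =
      (λ w → lev (lab w) , root-distance w , lev-range (lab w) (lab-range w))
    , (leaf , subst (Dist (HT L) root leaf) lev-leaf (root-distance leaf))
    where
      leaf-range : InRange (descend leftChild 1 h)
      leaf-range = descend-range leftChild-map 1 h ≤-refl ≤-refl
      leaf : Fin N
      leaf = vertex (descend leftChild 1 h) leaf-range
      lev-leaf : lev (lab leaf) ≡ h
      lev-leaf = trans (cong lev (lab-vertex _ leaf-range)) (trans (descend-lev leftChild-map 1 h ≤-refl) (cong (_+ h) lev-1))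

-- Far vertices in HT(k + 3): every vertex v has a vertex w such that every
-- walk from v to w has length ≥ k + 2.  The witness is a leaf, found by one
-- of the potentials: the level when v is the root, the side potential when
-- v is on level 1, and the region potential when v is deeper.

module FarVertices (k : ℕ) where
  h : ℕ
  h = suc (suc k)

  open Hypertree h

  Far : Fin N → Set
  Far v = Σ (Fin N) λ w → ∀ (p : Walk (HT L) v w) → h ≤ walkLength (HT L) p

  far-by-potential : ∀ {φ} → Lipschitz φ → ∀ v x (range : InRange x) c →
                     φ (lab v) ≤ c → h + c ≤ φ x → Far v
  far-by-potential {φ} lip v x range c φv≤c h+c≤φx = vertex x range , λ p → +-cancelʳ-≤ c h _ (begin
      h + c                               ≤⟨ h+c≤φx ⟩
      φ x                                 ≡⟨ cong φ (sym (lab-vertex x range)) ⟩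
      φ (lab (vertex x range))            ≤⟨ walk-potential lip p ⟩
      walkLength (HT L) p + φ (lab v)     ≤⟨ +-monoʳ-≤ (walkLength (HT L) p) φv≤c ⟩
      walkLength (HT L) p + c             ∎)
    where open ≤-Reasoning

  far-from-root : ∀ v → lev (lab v) ≡ 0 → Far v
  far-from-root v lev-v = far-by-potential lev-lipschitz v x range 0 (≤-reflexive lev-v) (≤-reflexive (sym lev-x))
    where
      x = descend leftChild 2 (suc k)
      range : InRange x
      range = descend-range leftChild-map 2 (suc k) (s≤s z≤n) (fits-below 2 (suc k) (m≤m+n 3 1))
      lev-x : lev x ≡ h + 0
      lev-x = trans (descend-lev leftChild-map 2 (suc k) (s≤s z≤n)) (trans (cong (_+ suc k) lev-2) (sym (+-identityʳ h)))

  far-on-level1 : ∀ v s r → lev (lab v) ≡ 1 → parity (side (lab v) + s) ≡ 0 →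
                  1 ≤ r → lev r ≡ 1 → parity (parity r + s) ≡ 1 → suc r ≤ 4 → Far v
  far-on-level1 v s r lev-v same 1≤r lev-r other r<4 =
    far-by-potential (sidePot-lipschitz s) v x range 1 (≤-reflexive (cong₂ sideWeight lev-v same))
      (≤-reflexive (sym (trans (sidePot-leaf s r (suc k) 1≤r lev-r) (cong (suc (suc k) +_) other))))
    where
      x = descend leftChild r (suc k)
      range : InRange x
      range = descend-range leftChild-map r (suc k) 1≤r (fits-below 2 (suc k) r<4)

  far-deep : ∀ v m c r → lev (lab v) ≡ suc (suc m) → parity (region (lab v) + c) ≡ 0 →
             1 ≤ r → lev r ≡ 2 → parity (parity r + c) ≡ 1 → suc r ≤ 8 → Far v
  far-deep v m c r lev-v same 1≤r lev-r other r<8 =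
    far-by-potential (regionPot-lipschitz L c) v x range L
      (≤-trans (≤-reflexive (cong₂ (regionWeight L) lev-v same)) (m∸n≤m L m))
      (≤-reflexive (trans (reorder k) (sym (trans (regionPot-leaf L c r k 1≤r lev-r) (cong (regionWeight L (2 + k)) other)))))
    where
      x = descend leftChild r k
      range : InRange x
      range = descend-range leftChild-map r k 1≤r (fits-below 3 k r<8)
      reorder : ∀ k → suc (suc k) + suc (suc (suc k)) ≡ suc (suc (suc k)) + 2 + k
      reorder = solve-∀

  far : ∀ v → Far v
  far v = by-level (lev (lab v)) refl
    where
      by-level : ∀ m → lev (lab v) ≡ m → Far v
      by-level zero lev-v = far-from-root v lev-v
      by-level (suc zero) lev-v with bit-0or1 1 (lab v)
      ... | inj₁ side0 = far-on-level1 v 0 3 lev-v (mismatch-cong 0 side0) (s≤s z≤n) lev-3 refl (m≤m+n 4 0)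
      ... | inj₂ side1 = far-on-level1 v 1 2 lev-v (mismatch-cong 1 side1) (s≤s z≤n) lev-2 refl (m≤m+n 3 1)
      by-level (suc (suc m)) lev-v with bit-0or1 2 (lab v)
      ... | inj₁ region0 = far-deep v m 0 5 lev-v (mismatch-cong 0 region0) (s≤s z≤n) lev-5 refl (m≤m+n 6 2)
      ... | inj₂ region1 = far-deep v m 1 4 lev-v (mismatch-cong 1 region1) (s≤s z≤n) lev-4 refl (m≤m+n 5 3)

  eccentricity-≥ : ∀ v e → Ecc (HT L) v e → h ≤ e
  eccentricity-≥ v e (within-e , _) =
    let (w , far-w) = far v
        (d , (((p , _) , len-p≡d) , _) , d≤e) = within-e w
    in ≤-trans (far-w p) (≤-trans (≤-reflexive len-p≡d) d≤e)

  radius : Radius (HT L) h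
  radius = (root , root-eccentricity) , eccentricity-≥

triangle-on-rim : ∀ i {a b} → a ≡ 2 * i + 1 → b ≡ 2 * i + 2 → 1 ≤ a × b ≡ suc a
triangle-on-rim i refl refl = subst (1 ≤_) (+-comm 1 (2 * i)) (s≤s z≤n) , +-suc (2 * i) 1

guest⊆wheel : ∀ g n {u v : Fin n} → guest g n u v → WheelAdjℕ n (toℕ u) (toℕ v)
guest⊆wheel wheel n e = e
guest⊆wheel fan n (inj₁ e) = inj₁ e
guest⊆wheel fan n (inj₂ (inj₁ e)) = inj₂ (inj₁ e)
guest⊆wheel fan n (inj₂ (inj₂ (inj₁ e))) = inj₂ (inj₂ (inj₁ e))
guest⊆wheel fan n (inj₂ (inj₂ (inj₂ e))) = inj₂ (inj₂ (inj₂ (inj₁ e)))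
guest⊆wheel friendship n (inj₁ e) = inj₁ e
guest⊆wheel friendship n (inj₂ (inj₁ e)) = inj₂ (inj₁ e)
guest⊆wheel friendship n (inj₂ (inj₂ (inj₁ (i , eu , ev)))) = inj₂ (inj₂ (inj₁ (triangle-on-rim i eu ev)))
guest⊆wheel friendship n (inj₂ (inj₂ (inj₂ (i , ev , eu)))) = inj₂ (inj₂ (inj₂ (inj₁ (triangle-on-rim i ev eu))))
guest⊆wheel star n (inj₁ e) = inj₁ e
guest⊆wheel star n (inj₂ e) = inj₂ (inj₁ e)

hub-adjacent : ∀ g n (u v : Fin n) → toℕ u ≡ 0 → toℕ v ≢ 0 → guest g n u v
hub-adjacent wheel n u v u≡0 v≢0 = inj₁ (u≡0 , v≢0)
hub-adjacent fan n u v u≡0 v≢0 = inj₁ (u≡0 , v≢0)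
hub-adjacent friendship n u v u≡0 v≢0 = inj₁ (u≡0 , v≢0)
hub-adjacent star n u v u≡0 v≢0 = inj₁ (u≡0 , v≢0)

-- The hub goes to the root; the rim
-- follows an in-order traversal of the subtree below 2 and then a mirrored
-- in-order traversal of the subtree below 3.  The traversals meet at the
-- rightmost leaves below 2 and 3, and the rim closes at the leftmost ones;
-- both pairs are joined by horizontal edges.

module WheelEmbedding (D : ℕ) where
  open Hypertree (suc D)

  tour : List ℕ
  tour = inorder false 2 D ++ inorder true 3 D

  cycle : List ℕ
  cycle = 1 ∷ tour

  fits-2 : Fits 2 D
  fits-2 = fits-below 2 D (m≤m+n 3 1)

  fits-3 : Fits 3 D
  fits-3 = fits-below 2 D ≤-refl

  across-near : ∀ {c} → ChildMap c → ShiftInvariant c → Near (suc D) (descend c 2 D) (descend c 3 D)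
  across-near isChild inv =
    inj₁ (step (sibling-leaves-across isChild inv D) (descend-range isChild 3 D (s≤s z≤n) fits-3) [] , s≤s z≤n)

  tour-chain : Chain (Near (suc D)) (descend leftChild 2 D) (descend leftChild 3 D) tour
  tour-chain = chain-++ (chain-map (near-weaken (n≤1+n D)) (inorder-chain false 2 D (s≤s z≤n) fits-2))
                        (across-near rightChild-map rightChild-shift)
                        (chain-map (near-weaken (n≤1+n D)) (inorder-chain true 3 D (s≤s z≤n) fits-3))

  cycle-length : length cycle ≡ N
  cycle-length = cong (_∸ 1) (begin
      suc (suc (length (first ++ second)))      ≡⟨ cong (λ n → suc (suc n)) (length-++ first) ⟩
      suc (suc (length first + length second))  ≡⟨ cong suc (sym (+-suc (length first) (length second))) ⟩
      suc (length first) + suc (length second)  ≡⟨ cong₂ _+_ (inorder-length false 2 D) (inorder-length true 3 D) ⟩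
      2 ^ suc D + 2 ^ suc D                     ≡⟨ cong (2 ^ suc D +_) (sym (+-identityʳ (2 ^ suc D))) ⟩
      2 ^ L                                     ∎)
    where
      open ≡-Reasoning
      first = inorder false 2 D
      second = inorder true 3 D

  cycle-range : ∀ {x} → x ∈ cycle → InRange x
  cycle-range (here refl) = subst InRange lab-root (lab-range root)
  cycle-range (there x∈tour) with ∈-++⁻ (inorder false 2 D) x∈tour
  ... | inj₁ x∈first = subtree-range (s≤s z≤n) fits-2 (inorder-subtree false 2 D x∈first)
  ... | inj₂ x∈second = subtree-range (s≤s z≤n) fits-3 (inorder-subtree true 3 D x∈second)

  cycle-unique : Unique cycle
  cycle-unique = All.tabulate 1∉tour
               ∷ ++⁺ (inorder-unique false 2 D (s≤s z≤n)) (inorder-unique true 3 D (s≤s z≤n)) disjoint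
    where
      1∉tour : ∀ {x} → x ∈ tour → 1 ≢ x
      1∉tour x∈tour refl with ∈-++⁻ (inorder false 2 D) x∈tour
      ... | inj₁ 1∈first with subtree-≥ (inorder-subtree false 2 D 1∈first)
      ...   | s≤s ()
      1∉tour x∈tour refl | inj₂ 1∈second with subtree-≥ (inorder-subtree true 3 D 1∈second)
      ...   | s≤s ()
      disjoint : ∀ {x} → ¬ (x ∈ inorder false 2 D × x ∈ inorder true 3 D)
      disjoint (x∈first , x∈second) with sibling-subtrees ≤-refl left right
                                           (inorder-subtree false 2 D x∈first) (inorder-subtree true 3 D x∈second)
      ... | ()

  spoke : ∀ b → b < length cycle → Near (suc D) 1 (at cycle b)
  spoke b b< = let range = cycle-range (at-∈ cycle b b<) in near-weaken (lev-range _ range) (root-near _ range)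

  rim : ∀ a b → 1 ≤ a → b ≡ suc a → b < length cycle → Near (suc D) (at cycle a) (at cycle b)
  rim (suc i) _ _ refl i+2< = chain-step tour-chain i (≤-pred i+2<)

  closing : Near (suc D) (at cycle 1) (at cycle (N ∸ 1))
  closing = subst₂ (Near (suc D)) (sym (chain-head tour-chain))
              (sym (trans (cong (λ n → at cycle (n ∸ 1)) (sym cycle-length)) (chain-last tour-chain 1)))
              (across-near leftChild-map leftChild-shift)

  wheel-near : ∀ a b → a < length cycle → b < length cycle → WheelAdjℕ N a b →
               Near (suc D) (at cycle a) (at cycle b)
  wheel-near _ b _ b< (inj₁ (refl , _)) = spoke b b<
  wheel-near a _ a< _ (inj₂ (inj₁ (refl , _))) = near-sym (spoke a a<)
  wheel-near a b _ b< (inj₂ (inj₂ (inj₁ (1≤a , b≡1+a)))) = rim a b 1≤a b≡1+a b<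
  wheel-near a b a< _ (inj₂ (inj₂ (inj₂ (inj₁ (1≤b , a≡1+b))))) = near-sym (rim b a 1≤b a≡1+b a<)
  wheel-near _ _ _ _ (inj₂ (inj₂ (inj₂ (inj₂ (inj₁ (refl , refl)))))) = closing
  wheel-near _ _ _ _ (inj₂ (inj₂ (inj₂ (inj₂ (inj₂ (refl , refl)))))) = near-sym closing

  index< : ∀ (u : Fin N) → toℕ u < length cycle
  index< u = subst (toℕ u <_) (sym cycle-length) (toℕ<n u)

  place : Fin N → Fin N
  place u = vertex (at cycle (toℕ u)) (cycle-range (at-∈ cycle (toℕ u) (index< u)))

  lab-place : ∀ u → lab (place u) ≡ at cycle (toℕ u)
  lab-place u = lab-vertex _ _

  place-injective : Injective _≡_ _≡_ place
  place-injective {u} {v} e = toℕ-injective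
    (at-injective cycle cycle-unique (toℕ u) (toℕ v) (index< u) (index< v)
      (trans (sym (lab-place u)) (trans (cong lab e) (lab-place v))))

  edge-path : ∀ u v → WheelAdjℕ N (toℕ u) (toℕ v) →
              Σ (Path (HT L) (place u) (place v)) λ p → pathLength (HT L) p ≤ suc D
  edge-path u v e = near⇒path (place u) (place v)
    (subst₂ (Near (suc D)) (sym (lab-place u)) (sym (lab-place v)) (wheel-near _ _ (index< u) (index< v) e))

  embedding : ∀ g → Embedding (guest g N) (HT L)
  embedding g = record
    { f   = place
    ; inj = place-injective
    ; P   = λ u v e → proj₁ (edge-path u v (guest⊆wheel g N e))
    }

  dilation-≤ : ∀ g u v (e : guest g N u v) → pathLength (HT L) (P (embedding g) u v e) ≤ suc D
  dilation-≤ g u v e = proj₂ (edge-path u v (guest⊆wheel g N e))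

-- an injective map Fin (m+1) → Fin (m+1) missing w would inject into Fin m
injective-misses-nothing : ∀ {m} (f : Fin (suc m) → Fin (suc m)) → Injective _≡_ _≡_ f →
                           ∀ w → ¬ (∀ u → w ≢ f u)
injective-misses-nothing {m} f inj w avoids with pigeonhole (n<1+n m) (λ u → punchOut (avoids u))
... | i , j , i<j , same = <ᶠ-irrefl (inj (punchOut-injective (avoids i) (avoids j) same)) i<j

injective⇒surjective : ∀ {n} (f : Fin n → Fin n) → Injective _≡_ _≡_ f → ∀ w → ∃ λ u → f u ≡ w
injective⇒surjective {suc m} f inj w with anyᶠ? (λ u → f u ≟ᶠ w)
... | yes hit = hit
... | no miss = ⊥-elim (injective-misses-nothing f inj w (λ u w≡fu → miss (u , sym w≡fu)))

-- Every embedding of a guest into HT(k + 3) stretches some spoke at the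
-- hub to length ≥ k + 2: the hub is placed somewhere, some vertex u is
-- placed at a vertex far from it, and u is adjacent to the hub.

module LowerBound (k : ℕ) where
  open Hypertree (suc (suc k))
  open FarVertices k using (far)

  root-index : toℕ root ≡ 0
  root-index = suc-injective lab-root

  dilation-≥ : ∀ g (e : Embedding (guest g N) (HT L)) →
               ∃[ u ] ∃[ v ] Σ (guest g N u v) λ edge → suc (suc k) ≤ pathLength (HT L) (P e u v edge)
  dilation-≥ g e with far (f e root)
  ... | w , far-w with injective⇒surjective (f e) (inj e) w
  ... | u , refl = root , u , edge , far-w (proj₁ (P e root u edge))
    where
      u-not-hub : toℕ u ≢ 0
      u-not-hub u≡0 with toℕ-injective (trans u≡0 (sym root-index))
      ... | refl with far-w []
      ... | ()
      edge : guest g N root u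
      edge = hub-adjacent g N root u root-index u-not-hub

theorem1 : ∀ (l : ℕ) → 3 ≤ l → (k : GuestKind) →
    Dil (guest k (2 ^ l ∸ 1)) (HT l) (l ∸ 1) × Radius (HT l) (l ∸ 1)
theorem1 (suc (suc (suc k))) _ g =
    ( (WheelEmbedding.embedding (suc k) g , WheelEmbedding.dilation-≤ (suc k) g)
    , LowerBound.dilation-≥ k g)
  , FarVertices.radius k
theorem1 (suc zero) (s≤s ()) _
theorem1 (suc (suc zero)) (s≤s (s≤s ())) _
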